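{- Let $A$ be a partially ordered set with top $\top$ and bottom $\bot$, and let $\mathcal C$ be a class of games over $A$ that is closed under equivalence $\equiv$ and under the four primitive gadgets: $G\in\mathcal C\Rightarrow\{\top\mid G\}\in\mathcal C$; $G\in\mathcal C\Rightarrow\{G\mid\bot\}\in\mathcal C$; $G,H\in\mathcal C\Rightarrow\{\{\top\mid G\},\{\top\mid H\}\mid\{G\mid\bot\},\{H\mid\bot\}\}\in\mathcal C$; $G,H\in\mathcal C\Rightarrow\{G,\{\top\mid H\}\mid\{G\mid\bot\},H\}\in\mathcal C$. If $G,H\in\mathcal C$, then $\{G,H\mid\bot\}\in\mathcal C$.
   Context: Games over $A$: for each $a\in A$, $[a]$ is an atomic game with no options; if $L,R$ are non-empty sets of games, $\{L\mid R\}$ is a composite game with left options $L$ and right options $R$. Inside braces an atom $x$ stands for $[x]$. $\le$ and $\lhd$ by mutual recursion: $G\le H$ iff every left option $G^L$ satisfies $G^L\lhd H$, every right option $H^R$ satisfies $G\lhd H^R$, and if $G$ or $H$ is atomic then $G\lhd H$; $G\lhd H$ iff some $G^R\le H$, or $G\le$ some $H^L$, or $G=[a],H=[b]$ with $a\le b$. $G\equiv H$ means $G\le H$ and $H\le G$. -}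

module Defs where

open import Level using (Level; _⊔_)
open import Data.List.NonEmpty using (List⁺; toList; _∷_; [_])
open import Data.List using ([]; _∷_)
open import Data.List.Relation.Unary.All using (All)
open import Data.List.Relation.Unary.Any using (Any)
open import Relation.Binary.Core using (Rel)

data Game {a : Level} (A : Set a) : Set a where
  atom : A → Game A
  ⟨_∣_⟩ : List⁺ (Game A) → List⁺ (Game A) → Game A

module Order {a ℓ : Level} {A : Set a} (_≤A_ : Rel A ℓ) where

  -- G ≤ H and G ⊲ H, by mutual recursion (given as a mutual inductive
  -- definition; games are well-founded, so this is the recursive definition).
  data _≤_ : Game A → Game A → Set (a ⊔ ℓ)
  data _⊲_ : Game A → Game A → Set (a ⊔ ℓ)

  data _≤_ where
    ≤-aa : ∀ {x y} → atom x ⊲ atom y → atom x ≤ atom y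
    ≤-ac : ∀ {x HL HR} → All (λ K → atom x ⊲ K) (toList HR)
         → atom x ⊲ ⟨ HL ∣ HR ⟩ → atom x ≤ ⟨ HL ∣ HR ⟩
    ≤-ca : ∀ {GL GR y} → All (λ K → K ⊲ atom y) (toList GL)
         → ⟨ GL ∣ GR ⟩ ⊲ atom y → ⟨ GL ∣ GR ⟩ ≤ atom y
    ≤-cc : ∀ {GL GR HL HR}
         → All (λ K → K ⊲ ⟨ HL ∣ HR ⟩) (toList GL)
         → All (λ K → ⟨ GL ∣ GR ⟩ ⊲ K) (toList HR)
         → ⟨ GL ∣ GR ⟩ ≤ ⟨ HL ∣ HR ⟩

  data _⊲_ where
    ⊲-R : ∀ {GL GR H} → Any (λ K → K ≤ H) (toList GR) → ⟨ GL ∣ GR ⟩ ⊲ H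
    ⊲-L : ∀ {G HL HR} → Any (λ K → G ≤ K) (toList HL) → G ⊲ ⟨ HL ∣ HR ⟩
    ⊲-atom : ∀ {x y} → x ≤A y → atom x ⊲ atom y

  _≡G_ : Game A → Game A → Set (a ⊔ ℓ)
  G ≡G H = (G ≤ H) × (H ≤ G)
    where open import Data.Product using (_×_)

{-# OPTIONS --safe #-}
-- {G, H | ⊥} is equivalent to the third gadget applied to {G | ⊥} and {H | ⊥}, both of
-- which C contains by the second gadget.  Each of G, H lies below the left option
-- {⊤ | {G | ⊥}} (resp. H), whose right option {G | ⊥} in turn lies below {G, H | ⊥};
-- the right options are matched because ⊥ lies below every game.
module Submission where

open import Defs
open import Level using (Level)
open import Data.Product using (_,_)
open import Data.List.NonEmpty using (toList; _∷_; [_])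
open import Data.List using ([]; _∷_)
open import Data.List.Relation.Unary.All as All using (All; []; _∷_)
open import Data.List.Relation.Unary.Any using (here; there)
open import Data.List.Membership.Propositional using (_∈_; lose)
open import Relation.Binary.Core using (Rel)
open import Relation.Binary.Bundles using (Poset)
open import Relation.Binary.Definitions using (Reflexive; Maximum; Minimum)
open import Relation.Binary.PropositionalEquality using (refl)

module GameOrder {a ℓ} {A : Set a} (_≤A_ : Rel A ℓ) where
  open Order _≤A_

  module _ (≤A-refl : Reflexive _≤A_) where
    mutual
      ≤-refl : ∀ G → G ≤ G
      ≤-refl (atom x) = ≤-aa (⊲-atom ≤A-refl)
      ≤-refl ⟨ L ∣ R ⟩ =
        ≤-cc (All.tabulate λ K∈L → ⊲-L (lose K∈L (All.lookup (≤-refl⁺ L) K∈L)))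
             (All.tabulate λ K∈R → ⊲-R (lose K∈R (All.lookup (≤-refl⁺ R) K∈R)))

      ≤-refl⁺ : ∀ Ks → All (λ K → K ≤ K) (toList Ks)
      ≤-refl⁺ (K ∷ Ks) = ≤-refl K ∷ ≤-refl* Ks

      ≤-refl* : ∀ Ks → All (λ K → K ≤ K) Ks
      ≤-refl* []       = []
      ≤-refl* (K ∷ Ks) = ≤-refl K ∷ ≤-refl* Ks

  module _ {top : A} (max : Maximum _≤A_ top) where
    mutual
      ≤-top : ∀ G → G ≤ atom top
      ≤-top (atom x)  = ≤-aa (⊲-top (atom x))
      ≤-top ⟨ L ∣ R ⟩ = ≤-ca (⊲-top⁺ L) (⊲-top ⟨ L ∣ R ⟩)

      ⊲-top : ∀ G → G ⊲ atom top
      ⊲-top (atom x)      = ⊲-atom (max x)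
      ⊲-top ⟨ _ ∣ R ∷ _ ⟩ = ⊲-R (here (≤-top R))

      ⊲-top⁺ : ∀ Ks → All (_⊲ atom top) (toList Ks)
      ⊲-top⁺ (K ∷ Ks) = ⊲-top K ∷ ⊲-top* Ks

      ⊲-top* : ∀ Ks → All (_⊲ atom top) Ks
      ⊲-top* []       = []
      ⊲-top* (K ∷ Ks) = ⊲-top K ∷ ⊲-top* Ks

  module _ {bot : A} (min : Minimum _≤A_ bot) where
    mutual
      bot-≤ : ∀ G → atom bot ≤ G
      bot-≤ (atom x)  = ≤-aa (bot-⊲ (atom x))
      bot-≤ ⟨ L ∣ R ⟩ = ≤-ac (bot-⊲⁺ R) (bot-⊲ ⟨ L ∣ R ⟩)

      bot-⊲ : ∀ G → atom bot ⊲ G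
      bot-⊲ (atom x)      = ⊲-atom (min x)
      bot-⊲ ⟨ L ∷ _ ∣ _ ⟩ = ⊲-L (here (bot-≤ L))

      bot-⊲⁺ : ∀ Ks → All (atom bot ⊲_) (toList Ks)
      bot-⊲⁺ (K ∷ Ks) = bot-⊲ K ∷ bot-⊲* Ks

      bot-⊲* : ∀ Ks → All (atom bot ⊲_) Ks
      bot-⊲* []       = []
      bot-⊲* (K ∷ Ks) = bot-⊲ K ∷ bot-⊲* Ks

module Gadgets {a ℓ} {A : Set a} (_≤A_ : Rel A ℓ) (≤A-refl : Reflexive _≤A_)
               {top bot : A} (max : Maximum _≤A_ top) (min : Minimum _≤A_ bot) where
  open Order _≤A_
  open GameOrder _≤A_

  ⟨⊤∣_⟩ : Game A → Game A
  ⟨⊤∣ G ⟩ = ⟨ [ atom top ] ∣ [ G ] ⟩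

  ⟨_∣⊥⟩ : Game A → Game A
  ⟨ G ∣⊥⟩ = ⟨ [ G ] ∣ [ atom bot ] ⟩

  cross : Game A → Game A → Game A
  cross G H = ⟨ ⟨⊤∣ G ⟩ ∷ ⟨⊤∣ H ⟩ ∷ [] ∣ ⟨ G ∣⊥⟩ ∷ ⟨ H ∣⊥⟩ ∷ [] ⟩

  ⊲-⟨⊤∣⟩ : ∀ G K → G ⊲ ⟨⊤∣ K ⟩
  ⊲-⟨⊤∣⟩ G _ = ⊲-L (here (≤-top max G))

  ⊲-⟨∣⊥⟩ : ∀ G → G ⊲ ⟨ G ∣⊥⟩
  ⊲-⟨∣⊥⟩ G = ⊲-L (here (≤-refl ≤A-refl G))

  ∣⊥-⊲ : ∀ {L} G → ⟨ L ∣ [ atom bot ] ⟩ ⊲ G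
  ∣⊥-⊲ G = ⊲-R (here (bot-≤ min G))

  ≤-⟨⊤∣⟨∣⊥⟩⟩ : ∀ G → G ≤ ⟨⊤∣ ⟨ G ∣⊥⟩ ⟩
  ≤-⟨⊤∣⟨∣⊥⟩⟩ (atom x)      = ≤-ac (⊲-⟨∣⊥⟩ (atom x) ∷ []) (⊲-⟨⊤∣⟩ (atom x) _)
  ≤-⟨⊤∣⟨∣⊥⟩⟩ G@(⟨ _ ∣ _ ⟩) = ≤-cc (All.tabulate λ {K} _ → ⊲-⟨⊤∣⟩ K _) (⊲-⟨∣⊥⟩ G ∷ [])

  ⟨∣⊥⟩-≤ : ∀ {G L R} → G ∈ toList L → ⟨ G ∣⊥⟩ ≤ ⟨ L ∣ R ⟩
  ⟨∣⊥⟩-≤ {G} G∈L = ≤-cc (⊲-L (lose G∈L (≤-refl ≤A-refl G)) ∷ [])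
                        (All.tabulate λ {K} _ → ∣⊥-⊲ K)

  cross-⟨∣⊥⟩-≡ : ∀ G H → cross ⟨ G ∣⊥⟩ ⟨ H ∣⊥⟩ ≡G ⟨ G ∷ H ∷ [] ∣ [ atom bot ] ⟩
  cross-⟨∣⊥⟩-≡ G H = cross≤pair , pair≤cross
    where
    cross≤pair : cross ⟨ G ∣⊥⟩ ⟨ H ∣⊥⟩ ≤ ⟨ G ∷ H ∷ [] ∣ [ atom bot ] ⟩
    cross≤pair = ≤-cc (⊲-R (here (⟨∣⊥⟩-≤ (here refl)))
                       ∷ ⊲-R (here (⟨∣⊥⟩-≤ (there (here refl)))) ∷ [])
                      (⊲-R (here (≤-ca (∣⊥-⊲ _ ∷ []) (∣⊥-⊲ _))) ∷ [])

    pair≤cross : ⟨ G ∷ H ∷ [] ∣ [ atom bot ] ⟩ ≤ cross ⟨ G ∣⊥⟩ ⟨ H ∣⊥⟩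
    pair≤cross = ≤-cc (⊲-L (here (≤-⟨⊤∣⟨∣⊥⟩⟩ G))
                       ∷ ⊲-L (there (here (≤-⟨⊤∣⟨∣⊥⟩⟩ H))) ∷ [])
                      (∣⊥-⊲ _ ∷ ∣⊥-⊲ _ ∷ [])

lemma3p5 : ∀ {c ℓ₁ ℓ₂ ℓ : Level} (P : Poset c ℓ₁ ℓ₂)
    → (top bot : Poset.Carrier P)
    → Maximum (Poset._≤_ P) top → Minimum (Poset._≤_ P) bot
    → (C : Game (Poset.Carrier P) → Set ℓ)
    → (∀ G H → Order._≡G_ (Poset._≤_ P) G H → C G → C H)
    → (∀ G → C G → C ⟨ [ atom top ] ∣ [ G ] ⟩)
    → (∀ G → C G → C ⟨ [ G ] ∣ [ atom bot ] ⟩)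
    → (∀ G H → C G → C H
         → C ⟨ ⟨ [ atom top ] ∣ [ G ] ⟩ ∷ ⟨ [ atom top ] ∣ [ H ] ⟩ ∷ []
             ∣ ⟨ [ G ] ∣ [ atom bot ] ⟩ ∷ ⟨ [ H ] ∣ [ atom bot ] ⟩ ∷ [] ⟩)
    → (∀ G H → C G → C H
         → C ⟨ G ∷ ⟨ [ atom top ] ∣ [ H ] ⟩ ∷ []
             ∣ ⟨ [ G ] ∣ [ atom bot ] ⟩ ∷ H ∷ [] ⟩)
    → ∀ G H → C G → C H → C ⟨ G ∷ H ∷ [] ∣ [ atom bot ] ⟩
lemma3p5 P _ _ max min _ C-≡ _ C-⟨∣⊥⟩ C-cross _ G H CG CH =
  C-≡ _ _ (cross-⟨∣⊥⟩-≡ G H) (C-cross _ _ (C-⟨∣⊥⟩ G CG) (C-⟨∣⊥⟩ H CH))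
  where open Gadgets (Poset._≤_ P) (Poset.refl P) max min
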